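{- Let $(X,\wedge,\vee,\bot,\top)$ be a bounded lattice which is not distributive. Then there exists a sequence $x=(x_1,x_2,x_3)$ in $X$ and some $k\in\{1,2,3\}$ such that \[ S_x(3,k)\neq S_x(2,k)\wedge\bigl(S_x(2,k-1)\vee x_3\bigr), \] where for $0\le m\le 3$ and $0\le k\le m+1$, \[ S_x(m,k)=\begin{cases}\bot & k=0,\\[2pt] \displaystyle\bigwedge_{I\subseteq\{1,\ldots,m\},\ |I|=k}\ \bigvee_{i\in I} x_i & 1\le k\le m,\\[2pt] \top & k=m+1.\end{cases} \]
   Context: $\bot$ and $\top$ denote the least and greatest elements of $X$. For $1\le k\le m$, $S_x(m,k)$ is the $k$-th entry of $(x_1,\ldots,x_m)$ "sorted with respect to the lattice", defined as the meet over all $k$-element subsets $I$ of $\{1,\ldots,m\}$ of $\bigvee_{i\in I}x_i$; the values at $k=0$ and $k=m+1$ are conventions. The claim says the recursive identity $S_x(n,k)=S_x(n-1,k)\wedge(S_x(n-1,k-1)\vee x_n)$ (for all $1\le k\le n$) fails for some sequence of length $n=3$. -}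

module Defs where

open import Level using (Level; _⊔_) renaming (suc to lsuc)
open import Data.Nat using (ℕ; zero; suc; _≤?_)
open import Data.Fin using (Fin)
import Data.Fin as F
open import Data.List using (List; []; _∷_; [_]; map; _++_; foldr)
open import Relation.Nullary using (yes; no)
open import Algebra.Lattice.Bundles using (Lattice)

record BoundedLattice (c ℓ : Level) : Set (lsuc (c ⊔ ℓ)) where
  field
    lattice : Lattice c ℓ
  open Lattice lattice public
  field
    ⊥ : Carrier
    ⊤ : Carrier
    ⊥-minimum : ∀ x → (⊥ ∨ x) ≈ x
    ⊤-maximum : ∀ x → (⊤ ∧ x) ≈ x

subsetsOfSize : (m k : ℕ) → List (List (Fin m))
subsetsOfSize m       zero    = [ [] ]
subsetsOfSize zero    (suc k) = []
subsetsOfSize (suc m) (suc k) =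
  map (λ s → F.zero ∷ map F.suc s) (subsetsOfSize m k) ++ map (map F.suc) (subsetsOfSize m (suc k))

module Sorted {c ℓ : Level} (L : BoundedLattice c ℓ) where
  open BoundedLattice L

  ⋁ : List Carrier → Carrier
  ⋁ = foldr _∨_ ⊥

  ⋀ : List Carrier → Carrier
  ⋀ = foldr _∧_ ⊤

  -- S x (m , k): the k-th entry of (x₁,…,xₘ) sorted w.r.t. the lattice.
  --   k = 0          ↦ ⊥
  --   1 ≤ k ≤ m      ↦ ⋀_{|I| = k} ⋁_{i ∈ I} x_i
  --   k = m + 1      ↦ ⊤   (values for k > m+1 are never used)
  S : (m : ℕ) → (Fin m → Carrier) → ℕ → Carrier
  S m x zero = ⊥
  S m x (suc k) with suc k ≤? m
  ... | yes _ = ⋀ (map (λ I → ⋁ (map x I)) (subsetsOfSize m (suc k)))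
  ... | no  _ = ⊤

-- S x (3 , 2) is the median (x₁ ∨ x₂) ∧ (x₁ ∨ x₃) ∧ (x₂ ∨ x₃), so the recursion at
-- n = 3, k = 2 bounds the median by (x₁ ∧ x₂) ∨ x₃. As (a ∨ b) ∧ c lies below the median
-- of b, c, a, this gives (a ∨ b) ∧ c ≤ a ∨ (b ∧ c) for all a, b, c, and two applications
-- of that inequality yield (y ∨ x) ∧ (z ∨ x) ≤ (y ∧ z) ∨ x, i.e. distributivity.
module Submission where

open import Defs
open import Level using (Level; _⊔_)
open import Data.Nat using (ℕ; _≤_; _∸_; s≤s; z≤n)
open import Data.Fin using (Fin; zero; suc; inject₁)
open import Function using (_∘_)
open import Data.Vec.Functional using ([]; _∷_)
open import Relation.Nullary using (¬_)
open import Algebra.Lattice.Bundles using (Lattice)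
open import Algebra.Lattice.Structures using (IsDistributiveLattice)
open import Algebra.Lattice.Structures.Biased using (isDistributiveLatticeʳʲᵐ)
import Algebra.Lattice.Properties.Lattice as LatticeProperties
import Relation.Binary.Lattice as OrderLattice
import Relation.Binary.Lattice.Properties.JoinSemilattice as JoinProperties
import Relation.Binary.Reasoning.PartialOrder as PosetReasoning

module LatticeOrder {c ℓ : Level} (L : Lattice c ℓ) where
  open Lattice L
  open import Algebra.Definitions _≈_ using (_DistributesOverʳ_)

  private
    orderLattice : OrderLattice.Lattice c ℓ ℓ
    orderLattice = LatticeProperties.∨-∧-orderTheoreticLattice L

  open OrderLattice.Lattice orderLattice public
    using (x≤x∨y; y≤x∨y; ∨-least; x∧y≤x; x∧y≤y; ∧-greatest; antisym; poset)
    renaming (_≤_ to _⊑_; refl to ⊑-refl; trans to ⊑-trans)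
  open JoinProperties (OrderLattice.Lattice.joinSemilattice orderLattice) public
    using (∨-monotonic)
  open PosetReasoning poset

  median : Carrier → Carrier → Carrier → Carrier
  median a b c = (a ∨ b) ∧ ((a ∨ c) ∧ (b ∨ c))

  ∨-∧-shift⇒∨-distribʳ-∧ : (∀ a b c → (a ∨ b) ∧ c ⊑ a ∨ (b ∧ c)) →
                           _∨_ DistributesOverʳ _∧_
  ∨-∧-shift⇒∨-distribʳ-∧ shift x y z = antisym lower upper
    where
    lower : (y ∧ z) ∨ x ⊑ (y ∨ x) ∧ (z ∨ x)
    lower = ∧-greatest (∨-monotonic (x∧y≤x y z) ⊑-refl)
                       (∨-monotonic (x∧y≤y y z) ⊑-refl)

    y∧[z∨x]⊑[y∧z]∨x : y ∧ (z ∨ x) ⊑ (y ∧ z) ∨ x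
    y∧[z∨x]⊑[y∧z]∨x = begin
      y ∧ (z ∨ x)   ≈⟨ ∧-comm y (z ∨ x) ⟩
      (z ∨ x) ∧ y   ≈⟨ ∧-congʳ (∨-comm z x) ⟩
      (x ∨ z) ∧ y   ≤⟨ shift x z y ⟩
      x ∨ (z ∧ y)   ≈⟨ ∨-comm x (z ∧ y) ⟩
      (z ∧ y) ∨ x   ≈⟨ ∨-congʳ (∧-comm z y) ⟩
      (y ∧ z) ∨ x   ∎

    upper : (y ∨ x) ∧ (z ∨ x) ⊑ (y ∧ z) ∨ x
    upper = begin
      (y ∨ x) ∧ (z ∨ x)   ≈⟨ ∧-congʳ (∨-comm y x) ⟩
      (x ∨ y) ∧ (z ∨ x)   ≤⟨ shift x y (z ∨ x) ⟩
      x ∨ (y ∧ (z ∨ x))   ≤⟨ ∨-least (y≤x∨y (y ∧ z) x) y∧[z∨x]⊑[y∧z]∨x ⟩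
      (y ∧ z) ∨ x         ∎

  ∨-∧-shift⇒isDistributiveLattice : (∀ a b c → (a ∨ b) ∧ c ⊑ a ∨ (b ∧ c)) →
                                    IsDistributiveLattice _≈_ _∨_ _∧_
  ∨-∧-shift⇒isDistributiveLattice shift = isDistributiveLatticeʳʲᵐ (record
    { isLattice    = isLattice
    ; ∨-distribʳ-∧ = ∨-∧-shift⇒∨-distribʳ-∧ shift
    })

  median⊑⇒isDistributiveLattice : (∀ a b c → median a b c ⊑ (a ∧ b) ∨ c) →
                                  IsDistributiveLattice _≈_ _∨_ _∧_
  median⊑⇒isDistributiveLattice median⊑ = ∨-∧-shift⇒isDistributiveLattice shift
    where
    shift : ∀ a b c → (a ∨ b) ∧ c ⊑ a ∨ (b ∧ c)
    shift a b c = begin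
      (a ∨ b) ∧ c                   ≤⟨ ∧-greatest c⊑b∨c (∧-greatest a∨b⊑b∨a c⊑c∨a) ⟩
      (b ∨ c) ∧ ((b ∨ a) ∧ (c ∨ a)) ≤⟨ median⊑ b c a ⟩
      (b ∧ c) ∨ a                   ≈⟨ ∨-comm (b ∧ c) a ⟩
      a ∨ (b ∧ c)                   ∎
      where
      c⊑b∨c : (a ∨ b) ∧ c ⊑ b ∨ c
      c⊑b∨c = ⊑-trans (x∧y≤y (a ∨ b) c) (y≤x∨y b c)
      a∨b⊑b∨a : (a ∨ b) ∧ c ⊑ b ∨ a
      a∨b⊑b∨a = ⊑-trans (x∧y≤x (a ∨ b) c) (∨-least (y≤x∨y b a) (x≤x∨y b a))
      c⊑c∨a : (a ∨ b) ∧ c ⊑ c ∨ a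
      c⊑c∨a = ⊑-trans (x∧y≤y (a ∨ b) c) (x≤x∨y c a)

module SortedValues {c ℓ : Level} (L : BoundedLattice c ℓ) where
  open BoundedLattice L
  open Sorted L
  open LatticeOrder lattice using (median)

  ∨-identityʳ : ∀ a → a ∨ ⊥ ≈ a
  ∨-identityʳ a = trans (∨-comm a ⊥) (⊥-minimum a)

  ∧-identityʳ : ∀ a → a ∧ ⊤ ≈ a
  ∧-identityʳ a = trans (∧-comm a ⊤) (⊤-maximum a)

  private
    ∨[∨⊥]≈∨ : ∀ a b → a ∨ (b ∨ ⊥) ≈ a ∨ b
    ∨[∨⊥]≈∨ a b = ∨-congˡ (∨-identityʳ b)

  S2-1≈∧ : ∀ y → S 2 y 1 ≈ y zero ∧ y (suc zero)
  S2-1≈∧ y = ∧-cong (∨-identityʳ (y zero))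
                    (trans (∧-identityʳ _) (∨-identityʳ (y (suc zero))))

  S2-2≈∨ : ∀ y → S 2 y 2 ≈ y zero ∨ y (suc zero)
  S2-2≈∨ y = trans (∧-identityʳ _) (∨[∨⊥]≈∨ (y zero) (y (suc zero)))

  S3-2≈median : ∀ x → S 3 x 2 ≈ median (x zero) (x (suc zero)) (x (suc (suc zero)))
  S3-2≈median x = ∧-cong (∨[∨⊥]≈∨ _ _)
                    (∧-cong (∨[∨⊥]≈∨ _ _) (trans (∧-identityʳ _) (∨[∨⊥]≈∨ _ _)))

  SortedRecursion₃ : Set (c ⊔ ℓ)
  SortedRecursion₃ = (x : Fin 3 → Carrier) (k : ℕ) → 1 ≤ k → k ≤ 3 →
    S 3 x k ≈ (S 2 (x ∘ inject₁) k ∧ (S 2 (x ∘ inject₁) (k ∸ 1) ∨ x (suc (suc zero))))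

  SortedRecursion₃⇒median≈ : SortedRecursion₃ →
                             ∀ a b c → median a b c ≈ (a ∨ b) ∧ ((a ∧ b) ∨ c)
  SortedRecursion₃⇒median≈ recursion a b c = begin
    median a b c                      ≈⟨ sym (S3-2≈median x) ⟩
    S 3 x 2                           ≈⟨ recursion x 2 (s≤s z≤n) (s≤s (s≤s z≤n)) ⟩
    S 2 y 2 ∧ (S 2 y 1 ∨ c)           ≈⟨ ∧-cong (S2-2≈∨ y) (∨-congʳ (S2-1≈∧ y)) ⟩
    (a ∨ b) ∧ ((a ∧ b) ∨ c)           ∎
    where
    open import Relation.Binary.Reasoning.Setoid setoid
    x : Fin 3 → Carrier
    x = a ∷ b ∷ c ∷ []
    y : Fin 2 → Carrier
    y = x ∘ inject₁

proposition3p2 : {c ℓ : Level} (L : BoundedLattice c ℓ) →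
    let open BoundedLattice L
        open Sorted L
    in ¬ IsDistributiveLattice _≈_ _∨_ _∧_ →
       ¬ ((x : Fin 3 → Carrier) (k : ℕ) → 1 ≤ k → k ≤ 3 →
          S 3 x k ≈ (S 2 (x ∘ inject₁) k ∧ (S 2 (x ∘ inject₁) (k ∸ 1) ∨ x (suc (suc zero)))))
proposition3p2 L nondistributive recursion =
  nondistributive (median⊑⇒isDistributiveLattice median⊑)
  where
  open BoundedLattice L using (lattice; _∨_; _∧_)
  open LatticeOrder lattice
  open SortedValues L using (SortedRecursion₃⇒median≈)
  open PosetReasoning poset

  median⊑ : ∀ a b c → median a b c ⊑ (a ∧ b) ∨ c
  median⊑ a b c = begin
    median a b c             ≈⟨ SortedRecursion₃⇒median≈ recursion a b c ⟩
    (a ∨ b) ∧ ((a ∧ b) ∨ c)  ≤⟨ x∧y≤y (a ∨ b) _ ⟩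
    (a ∧ b) ∨ c              ∎
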